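{- Let $e\geq 2$, $l\geq 1$ and $\mathbf{s}=(s_1,\ldots,s_l)\in\overline{\mathcal{A}}^l_e$. Then $\tau_{e,\mathbf{s}}(\emptyset,\ldots,\emptyset)$ is an $e$-core.
   Context: A partition is a nonincreasing sequence $\lambda=(\lambda_1\geq\lambda_2\geq\cdots)$ of nonnegative integers with finitely many nonzero terms; an $l$-partition is an $l$-tuple of partitions. For a partition $\lambda$ and $s\in\mathbb{Z}$, set $L_s(\lambda)=\{\lambda_j-j+s: j\geq1\}\subset\mathbb{Z}$. Every subset $L\subset\mathbb{Z}$ which contains all sufficiently negative integers and no sufficiently large integers is of the form $L=L_t(\mu)$ for a unique partition $\mu$ and a unique $t\in\mathbb{Z}$; call $\mu$ the partition associated with $L$. Define $\overline{\mathcal{A}}^l_e=\{(s_1,\ldots,s_l)\in\mathbb{Z}^l: 0\leq s_j-s_i\leq e\text{ for all }1\leq i<j\leq l\}$. Uglov map: for an $l$-partition $\boldsymbol{\lambda}=(\lambda^1,\ldots,\lambda^l)$ and $\mathbf{s}\in\mathbb{Z}^l$, let $L\subset\mathbb{Z}$ be the set of all integers $(l-c)e+qel+r$ where $c\in\{1,\ldots,l\}$ and $k=qe+r\in L_{s_c}(\lambda^c)$ with $q\in\mathbb{Z}$, $r\in\{0,\ldots,e-1\}$; then $\tau_{e,\mathbf{s}}(\boldsymbol{\lambda})$ is the partition associated with $L$. An $e$-core is a partition from which no rim $e$-hook can be removed. -}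

module Defs where

open import Data.Nat as ℕ using (ℕ; zero; suc)
open import Data.Integer as ℤ using (ℤ; +_)
open import Data.List using (List; []; _∷_)
open import Data.Nat.ListAction using (sum)
open import Data.List.Relation.Unary.All using (All)
open import Data.List.Relation.Unary.Linked using (Linked)
open import Data.Fin using (Fin; toℕ)
open import Data.Product using (Σ; ∃; _×_; _,_)
open import Relation.Binary.PropositionalEquality using (_≡_)
open import Relation.Nullary using (¬_)

-- A partition is a finite nonincreasing list of positive naturals
-- (its nonzero parts); all further parts are 0.
IsPartition : List ℕ → Set
IsPartition xs = Linked ℕ._≥_ xs × All (λ x → 0 ℕ.< x) xs

-- part λ i = λ_{i+1}  (0-indexed), 0 beyond the length
part : List ℕ → ℕ → ℕ
part []       _       = 0
part (x ∷ _)  zero    = x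
part (_ ∷ xs) (suc i) = part xs i

-- L_s(λ) = { λ_j - j + s : j ≥ 1 }, here with j = suc i
InL : ℤ → List ℕ → ℤ → Set
InL s λ' x = ∃ λ (i : ℕ) → x ≡ (+ part λ' i ℤ.- + suc i) ℤ.+ s

InAbar : (e l : ℕ) → (Fin l → ℤ) → Set
InAbar e l s = ∀ (i j : Fin l) → toℕ i ℕ.< toℕ j →
  (s i ℤ.≤ s j) × (s j ℤ.≤ s i ℤ.+ + e)

-- The set L of the Uglov map: all (l-c)e + q e l + r with c ∈ {1..l},
-- k = q e + r ∈ L_{s_c}(λ^c), 0 ≤ r < e.  Here c is encoded by
-- c' : Fin l with c = toℕ c' + 1, so l - c = l ∸ suc (toℕ c').
UglovSet : (e l : ℕ) → (Fin l → List ℕ) → (Fin l → ℤ) → ℤ → Set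
UglovSet e l λs s x =
  Σ (Fin l) λ c → Σ ℤ λ k → Σ ℤ λ q → Σ ℕ λ r →
    InL (s c) (λs c) k × r ℕ.< e × k ≡ q ℤ.* + e ℤ.+ + r ×
    x ≡ (+ ((l ℕ.∸ suc (toℕ c)) ℕ.* e) ℤ.+ q ℤ.* + (e ℕ.* l)) ℤ.+ + r

-- Young diagram cells (row, column), 0-indexed
Cell : Set
Cell = ℕ × ℕ

InDiagram : List ℕ → Cell → Set
InDiagram λ' (i , j) = j ℕ.< part λ' i

InSkew : List ℕ → List ℕ → Cell → Set
InSkew λ' ν c = InDiagram λ' c × ¬ InDiagram ν c

data Adj : Cell → Cell → Set where
  down  : ∀ {i j} → Adj (i , j) (suc i , j)
  up    : ∀ {i j} → Adj (suc i , j) (i , j)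
  right : ∀ {i j} → Adj (i , j) (i , suc j)
  left  : ∀ {i j} → Adj (i , suc j) (i , j)

data Path (S : Cell → Set) : Cell → Cell → Set where
  here : ∀ {a} → S a → Path S a a
  step : ∀ {a b c} → S a → Adj a b → Path S b c → Path S a c

Connected : (Cell → Set) → Set
Connected S = ∀ a b → S a → S b → Path S a b

No2x2 : (Cell → Set) → Set
No2x2 S = ∀ i j → ¬ (S (i , j) × S (suc i , j) × S (i , suc j) × S (suc i , suc j))

IsRimHook : ℕ → List ℕ → List ℕ → Set
IsRimHook e λ' ν =
  IsPartition ν × (∀ i → part ν i ℕ.≤ part λ' i) ×
  Connected (InSkew λ' ν) × No2x2 (InSkew λ' ν) × sum λ' ≡ sum ν ℕ.+ e

IsCore : ℕ → List ℕ → Set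
IsCore e λ' = ¬ (Σ (List ℕ) λ ν → IsRimHook e λ' ν)

module Submission where

-- A partition μ is determined by its β-set L_t(μ) = {μ_i − i + t},
-- and μ is an e-core as soon as this set is closed under x ↦ x − e: a rim
-- e-hook μ/ν running from row a down to row b satisfies e = μ_a − ν_b + (b − a)
-- (consecutive hook rows overlap in exactly one column), so closure applied
-- to the β-number of row a produces μ_j − j = ν_b − b, which is impossible
-- since rows j ≤ b of μ are longer and rows j > b shorter than that.

open import Defs
open import Data.Nat using (ℕ; _≤_)
open import Data.Integer using (ℤ)
open import Data.List using (List; [])
open import Data.Fin using (Fin)
open import Data.Product using (Σ; _×_)
open import Function.Bundles using (_⇔_)

import Data.Nat as N
open N using (zero; suc; z≤n; s≤s)
import Data.Nat.Properties as NP
open import Data.Nat.Tactic.RingSolver using (solve-∀)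
open import Data.List using (_∷_; length)
open import Data.Nat.ListAction using (sum)
open import Data.List.Relation.Unary.All using (All; _∷_)
open import Data.List.Relation.Unary.Linked using (Linked; [-]; _∷_)
open import Data.Product using (∃; _,_; proj₁; proj₂)
open import Data.Sum using (_⊎_; inj₁; inj₂)
open import Data.Empty using (⊥; ⊥-elim)
open import Relation.Nullary using (¬_; Dec; yes; no)
open import Relation.Binary.Definitions using (tri<; tri≈; tri>)
open import Relation.Binary.PropositionalEquality
open import Function.Bundles using (mk⇔; Equivalence)
open Equivalence using (to; from)
open import Function.Construct.Composition using (_⇔-∘_)
open import Function.Construct.Symmetry using (⇔-sym)
open import Data.Sum.Function.Propositional using (_⊎-⇔_)
import Data.Integer as Z
open Z using (+_; -[1+_])
import Data.Integer.Properties as ZP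
import Data.Integer.Tactic.RingSolver as ZR
import Data.Integer.DivMod as ZD
import Data.Nat.DivMod as ND
import Data.Fin as F
import Data.Fin.Properties as FP
open import Relation.Nullary.Decidable using (_×-dec_)
import Relation.Nullary.Decidable as Dec

part-suc≤ : ∀ {xs} → Linked N._≥_ xs → ∀ i → part xs (suc i) ≤ part xs i
part-suc≤ {[]}         _          i       = z≤n
part-suc≤ {x ∷ []}     _          i       = z≤n
part-suc≤ {x ∷ y ∷ xs} (x≥y ∷ _)  zero    = x≥y
part-suc≤ {x ∷ y ∷ xs} (_ ∷ desc) (suc i) = part-suc≤ desc i

part-anti : ∀ {xs} → Linked N._≥_ xs → ∀ {i j} → i ≤ j → part xs j ≤ part xs i
part-anti desc i≤j with NP.m≤n⇒m<n∨m≡n i≤j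
... | inj₂ refl = NP.≤-refl
... | inj₁ (s≤s {n = j'} i≤j') = NP.≤-trans (part-suc≤ desc j') (part-anti desc i≤j')

part-beyond : ∀ xs {i} → length xs ≤ i → part xs i ≡ 0
part-beyond []       _         = refl
part-beyond (x ∷ xs) (s≤s len≤i) = part-beyond xs len≤i

psum : (ℕ → ℕ) → ℕ → ℕ
psum f zero    = 0
psum f (suc n) = psum f n N.+ f n

psum-ext : ∀ {f g} → (∀ i → f i ≡ g i) → ∀ n → psum f n ≡ psum g n
psum-ext f≗g zero    = refl
psum-ext f≗g (suc n) = cong₂ N._+_ (psum-ext f≗g n) (f≗g n)

psum-+ : ∀ f g n → psum (λ i → f i N.+ g i) n ≡ psum f n N.+ psum g n
psum-+ f g zero    = refl
psum-+ f g (suc n) rewrite psum-+ f g n = swap (psum f n) (psum g n) (f n) (g n)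
  where
  swap : ∀ a b c d → a N.+ b N.+ (c N.+ d) ≡ a N.+ c N.+ (b N.+ d)
  swap = solve-∀

psum-suc : ∀ f n → psum f (suc n) ≡ f 0 N.+ psum (λ i → f (suc i)) n
psum-suc f zero    = NP.+-comm 0 (f 0)
psum-suc f (suc n) = trans (cong (N._+ f (suc n)) (psum-suc f n)) (NP.+-assoc (f 0) _ _)

sum≡psum : ∀ xs {N} → length xs ≤ N → sum xs ≡ psum (part xs) N
sum≡psum []       {N}     _           = sym (empty N)
  where
  empty : ∀ n → psum (part []) n ≡ 0
  empty zero    = refl
  empty (suc n) = trans (NP.+-identityʳ _) (empty n)
sum≡psum (x ∷ xs) {suc N} (s≤s len≤N) =
  trans (cong (x N.+_) (sum≡psum xs len≤N)) (sym (psum-suc (part (x ∷ xs)) N))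

firstPositive : ∀ f N → 0 N.< psum f N →
  Σ ℕ λ a → a N.< N × 0 N.< f a × psum f a ≡ 0
firstPositive f (suc n) pos with psum f n N.≟ 0
... | yes before≡0 = n , NP.≤-refl , subst (0 N.<_) (cong (N._+ f n) before≡0) pos , before≡0
... | no  before≢0 =
  let (a , a<n , fa>0 , pre) = firstPositive f n (NP.n≢0⇒n>0 before≢0)
  in  a , NP.m<n⇒m<1+n a<n , fa>0 , pre

psum-zeroLast : ∀ f n → f n ≡ 0 → psum f (suc n) ≡ psum f n
psum-zeroLast f n fn≡0 = trans (cong (psum f n N.+_) fn≡0) (NP.+-identityʳ _)

lastPositive : ∀ f N → 0 N.< psum f N →
  Σ ℕ λ b → b N.< N × 0 N.< f b × psum f N ≡ psum f (suc b) ×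
            (∀ i → b N.< i → i N.< N → f i ≡ 0)
lastPositive f (suc n) pos with f n N.≟ 0
... | no  fn≢0 = n , NP.≤-refl , NP.n≢0⇒n>0 fn≢0 , refl ,
                 λ i n<i i<1+n → ⊥-elim (NP.<⇒≱ n<i (NP.≤-pred i<1+n))
... | yes fn≡0 with lastPositive f n (subst (0 N.<_) (psum-zeroLast f n fn≡0) pos)
...   | b , b<n , fb>0 , tot , post =
  b , NP.m<n⇒m<1+n b<n , fb>0 , trans (psum-zeroLast f n fn≡0) tot , post'
  where
  post' : ∀ i → b N.< i → i N.< suc n → f i ≡ 0
  post' i b<i i<1+n with NP.m≤n⇒m<n∨m≡n (NP.≤-pred i<1+n)
  ... | inj₁ i<n  = post i b<i i<n
  ... | inj₂ refl = fn≡0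

unit-steps : ∀ (g : ℕ → ℕ) {a b} → a ≤ b →
  (∀ j → a ≤ j → j N.< b → g (suc j) ≡ suc (g j)) → g b N.+ a ≡ g a N.+ b
unit-steps g {b = zero}  z≤n     inc = refl
unit-steps g {a} {suc b} a≤1+b inc with NP.m≤n⇒m<n∨m≡n a≤1+b
... | inj₂ refl       = refl
... | inj₁ (s≤s a≤b) = begin
  g (suc b) N.+ a    ≡⟨ cong (N._+ a) (inc b a≤b NP.≤-refl) ⟩
  suc (g b N.+ a)    ≡⟨ cong suc (unit-steps g a≤b (λ j a≤j j<b → inc j a≤j (NP.m<n⇒m<1+n j<b))) ⟩
  suc (g a N.+ b)    ≡⟨ sym (NP.+-suc (g a) b) ⟩
  g a N.+ suc b      ∎
  where open ≡-Reasoning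

row : Cell → ℕ
row = proj₁

pathStart : ∀ {S a c} → Path S a c → S a
pathStart (here s)     = s
pathStart (step s _ _) = s

no-crossing-edge : ∀ μ ν i → part μ (suc i) ≤ part ν i → ∀ {u v} → Adj u v →
  InSkew μ ν u → InSkew μ ν v → row u ≤ i → i N.< row v → ⊥
no-crossing-edge μ ν i fits down (_ , u∉ν) (v∈μ , _) u≤i i<v
  with NP.≤-antisym u≤i (NP.≤-pred i<v)
... | refl = u∉ν (NP.<-≤-trans v∈μ fits)
no-crossing-edge μ ν i fits up    _ _ u≤i i<v = NP.<⇒≱ i<v (NP.≤-trans (NP.n≤1+n _) u≤i)
no-crossing-edge μ ν i fits right _ _ u≤i i<v = NP.<⇒≱ i<v u≤i
no-crossing-edge μ ν i fits left  _ _ u≤i i<v = NP.<⇒≱ i<v u≤i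

no-crossing : ∀ μ ν i → part μ (suc i) ≤ part ν i → ∀ {x y} → Path (InSkew μ ν) x y →
  row x ≤ i → i N.< row y → ⊥
no-crossing μ ν i fits (here _) x≤i i<y = NP.<⇒≱ i<y x≤i
no-crossing μ ν i fits (step {b = z} sx adj p) x≤i i<y with row z N.≤? i
... | yes z≤i = no-crossing μ ν i fits p z≤i i<y
... | no  z≰i = no-crossing-edge μ ν i fits adj sx (pathStart p) x≤i (NP.≰⇒> z≰i)

rows-overlap : ∀ {μ ν} → Linked N._≥_ μ → Linked N._≥_ ν → No2x2 (InSkew μ ν) →
  ∀ i {x y} → Path (InSkew μ ν) x y → row x ≤ i → i N.< row y →
  part μ (suc i) ≡ suc (part ν i)
rows-overlap {μ} {ν} descμ descν no2x2 i p x≤i i<y with part μ (suc i) N.≤? part ν i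
... | yes fits = ⊥-elim (no-crossing μ ν i fits p x≤i i<y)
... | no  ν<μ' with part μ (suc i) N.≤? suc (part ν i)
...   | yes μ'≤ = NP.≤-antisym μ'≤ (NP.≰⇒> ν<μ')
...   | no  μ'≰ = ⊥-elim (no2x2 i (part ν i) (cell₀₀ , cell₁₀ , cell₀₁ , cell₁₁))
  where
  -- otherwise μ_{i+1} ≥ ν_i + 2, and the cells in columns ν_i, ν_i + 1 of
  -- rows i, i + 1 form a 2×2 square of μ/ν
  wide : suc (suc (part ν i)) ≤ part μ (suc i)
  wide = NP.≰⇒> μ'≰
  wide' : suc (part ν i) ≤ part μ (suc i)
  wide' = NP.≤-trans (NP.n≤1+n _) wide
  μ↓ : part μ (suc i) ≤ part μ i
  μ↓ = part-suc≤ descμ i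
  ν↓ : part ν (suc i) ≤ part ν i
  ν↓ = part-suc≤ descν i
  cell₀₀ : InSkew μ ν (i , part ν i)
  cell₀₀ = NP.≤-trans wide' μ↓ , NP.<-irrefl refl
  cell₁₀ : InSkew μ ν (suc i , part ν i)
  cell₁₀ = wide' , λ lt → NP.<-irrefl refl (NP.<-≤-trans lt ν↓)
  cell₀₁ : InSkew μ ν (i , suc (part ν i))
  cell₀₁ = NP.≤-trans wide μ↓ , λ lt → NP.<-irrefl refl (NP.<-trans (NP.n<1+n _) lt)
  cell₁₁ : InSkew μ ν (suc i , suc (part ν i))
  cell₁₁ = wide , λ lt → NP.<-irrefl refl (NP.<-trans (NP.n<1+n _) (NP.<-≤-trans lt ν↓))

-- If μ/ν is a rim e-hook (e ≥ 1) with top row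
-- top and bottom row bot, then row bot of the hook is nonempty, row bot+1 of
-- μ fits under row bot of ν, and e + ν_bot + top = μ_top + bot: consecutive
-- hook rows overlap in one column, so e = μ_top − ν_bot + (bot − top).
module RimHookEnds {e : ℕ} {μ ν : List ℕ} (e≥1 : 1 ≤ e) (descμ : Linked N._≥_ μ)
                   (hook : IsRimHook e μ ν) where


  descν : Linked N._≥_ ν
  descν = proj₁ (proj₁ hook)
  ν⊆μ : ∀ i → part ν i ≤ part μ i
  ν⊆μ = proj₁ (proj₂ hook)
  connected : Connected (InSkew μ ν)
  connected = proj₁ (proj₂ (proj₂ hook))
  no2x2 : No2x2 (InSkew μ ν)
  no2x2 = proj₁ (proj₂ (proj₂ (proj₂ hook)))
  size : sum μ ≡ sum ν N.+ e
  size = proj₂ (proj₂ (proj₂ (proj₂ hook)))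

  d : ℕ → ℕ
  d i = part μ i N.∸ part ν i

  μ≡ν+d : ∀ i → part μ i ≡ part ν i N.+ d i
  μ≡ν+d i = sym (NP.m+[n∸m]≡n (ν⊆μ i))

  N : ℕ
  N = length μ N.+ length ν

  hookSize : psum d N ≡ e
  hookSize = NP.+-cancelˡ-≡ (psum (part ν) N) _ _ (begin
    psum (part ν) N N.+ psum d N          ≡⟨ sym (psum-+ (part ν) d N) ⟩
    psum (λ i → part ν i N.+ d i) N       ≡⟨ sym (psum-ext μ≡ν+d N) ⟩
    psum (part μ) N                       ≡⟨ sym (sum≡psum μ (NP.m≤m+n _ _)) ⟩
    sum μ                                 ≡⟨ size ⟩
    sum ν N.+ e                           ≡⟨ cong (N._+ e) (sum≡psum ν (NP.m≤n+m (length ν) (length μ))) ⟩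
    psum (part ν) N N.+ e                 ∎)
    where open ≡-Reasoning

  hookNonempty : 0 N.< psum d N
  hookNonempty = subst (0 N.<_) (sym hookSize) e≥1

  top bot : ℕ
  top = proj₁ (firstPositive d N hookNonempty)
  bot = proj₁ (lastPositive d N hookNonempty)

  top-row : 0 N.< d top
  top-row = proj₁ (proj₂ (proj₂ (firstPositive d N hookNonempty)))
  above-top : psum d top ≡ 0
  above-top = proj₂ (proj₂ (proj₂ (firstPositive d N hookNonempty)))

  bot<N : bot N.< N
  bot<N = proj₁ (proj₂ (lastPositive d N hookNonempty))
  bot-row : 0 N.< d bot
  bot-row = proj₁ (proj₂ (proj₂ (lastPositive d N hookNonempty)))
  up-to-bot : psum d N ≡ psum d (suc bot)
  up-to-bot = proj₁ (proj₂ (proj₂ (proj₂ (lastPositive d N hookNonempty))))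
  below-bot : ∀ i → bot N.< i → i N.< N → d i ≡ 0
  below-bot = proj₂ (proj₂ (proj₂ (proj₂ (lastPositive d N hookNonempty))))

  nonempty-row : ∀ i → 0 N.< d i → part ν i N.< part μ i
  nonempty-row i di>0 = NP.m∸n≢0⇒n<m (λ di≡0 → NP.<-irrefl (sym di≡0) di>0)

  top≤bot : top ≤ bot
  top≤bot with top N.≤? bot
  ... | yes le = le
  ... | no  gt = ⊥-elim (NP.<-irrefl (sym (below-bot top (NP.≰⇒> gt) top<N)) top-row)
    where
    top<N : top N.< N
    top<N = proj₁ (proj₂ (firstPositive d N hookNonempty))

  topCell : InSkew μ ν (top , part ν top)
  topCell = nonempty-row top top-row , NP.<-irrefl refl
  botCell : InSkew μ ν (bot , part ν bot)
  botCell = nonempty-row bot bot-row , NP.<-irrefl refl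

  -- g j = (cells of the hook in rows ≤ j) + ν_j grows by one per hook row
  g : ℕ → ℕ
  g j = psum d (suc j) N.+ part ν j

  g-step : ∀ j → top ≤ j → j N.< bot → g (suc j) ≡ suc (g j)
  g-step j top≤j j<bot = begin
    psum d (suc j) N.+ d (suc j) N.+ part ν (suc j)   ≡⟨ NP.+-assoc (psum d (suc j)) _ _ ⟩
    psum d (suc j) N.+ (d (suc j) N.+ part ν (suc j)) ≡⟨ cong (psum d (suc j) N.+_) (trans (NP.+-comm _ (part ν (suc j))) (sym (μ≡ν+d (suc j)))) ⟩
    psum d (suc j) N.+ part μ (suc j)                 ≡⟨ cong (psum d (suc j) N.+_) oneColumn ⟩
    psum d (suc j) N.+ suc (part ν j)                 ≡⟨ NP.+-suc (psum d (suc j)) _ ⟩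
    suc (g j)                                         ∎
    where
    open ≡-Reasoning
    oneColumn : part μ (suc j) ≡ suc (part ν j)
    oneColumn = rows-overlap descμ descν no2x2 j (connected _ _ topCell botCell) top≤j j<bot

  g-top : g top ≡ part μ top
  g-top = begin
    psum d top N.+ d top N.+ part ν top ≡⟨ cong (λ z → z N.+ d top N.+ part ν top) above-top ⟩
    d top N.+ part ν top                ≡⟨ trans (NP.+-comm (d top) _) (sym (μ≡ν+d top)) ⟩
    part μ top                          ∎
    where open ≡-Reasoning

  g-bot : g bot ≡ e N.+ part ν bot
  g-bot = cong (N._+ part ν bot) (trans (sym up-to-bot) hookSize)

  ends : e N.+ part ν bot N.+ top ≡ part μ top N.+ bot
  ends = subst₂ (λ x y → x N.+ top ≡ y N.+ bot) g-bot g-top (unit-steps g top≤bot g-step)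

  bot-fits : part μ (suc bot) ≤ part ν bot
  bot-fits with suc bot N.<? N
  ... | yes 1+bot<N = NP.≤-trans (NP.m∸n≡0⇒m≤n (below-bot (suc bot) NP.≤-refl 1+bot<N)) (part-suc≤ descν bot)
  ... | no  1+bot≮N = subst (_≤ part ν bot) (sym (part-beyond μ (NP.≤-trans (NP.m≤m+n _ _) (NP.≮⇒≥ 1+bot≮N)))) z≤n

-- The bottom row b of such a hook yields ν_b − b, which is not of the form
-- μ_j − j: rows j ≤ b of μ are too long and rows j > b too short.
bottom-not-β : ∀ {μ ν b} → Linked N._≥_ μ → part ν b N.< part μ b →
  part μ (suc b) ≤ part ν b → ∀ j → part μ j N.+ b ≢ part ν b N.+ j
bottom-not-β {μ} {ν} {b} descμ ν<μ fits j eq with j N.≤? b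
... | yes j≤b = NP.<-irrefl (sym eq) (begin-strict
  part ν b N.+ j  <⟨ NP.+-monoˡ-< j ν<μ ⟩
  part μ b N.+ j  ≤⟨ NP.+-mono-≤ (part-anti descμ j≤b) j≤b ⟩
  part μ j N.+ b  ∎)
  where open NP.≤-Reasoning
... | no  j≰b = NP.<-irrefl eq (begin-strict
  part μ j N.+ b  ≤⟨ NP.+-monoˡ-≤ b (NP.≤-trans (part-anti descμ (NP.≰⇒> j≰b)) fits) ⟩
  part ν b N.+ b  <⟨ NP.+-monoʳ-< (part ν b) (NP.≰⇒> j≰b) ⟩
  part ν b N.+ j  ∎)
  where open NP.≤-Reasoning

-- Applying closure to the top row a of a rim
-- hook and comparing with e + ν_b + a = μ_a + b contradicts bottom-not-β.
closed⇒core : ∀ {e μ} → 1 ≤ e → IsPartition μ →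
  (∀ i → ∃ λ j → part μ j N.+ i N.+ e ≡ part μ i N.+ j) → IsCore e μ
closed⇒core {e} {μ} e≥1 (descμ , _) closed (ν , hook) =
  bottom-not-β {ν = ν} descμ (nonempty-row bot bot-row) bot-fits j shifted
  where
  open RimHookEnds e≥1 descμ hook
  j : ℕ
  j = proj₁ (closed top)
  shifted : part μ j N.+ bot ≡ part ν bot N.+ j
  shifted = NP.+-cancelʳ-≡ (top N.+ e) _ _ (begin
    part μ j N.+ bot N.+ (top N.+ e)  ≡⟨ rearrange₁ (part μ j) bot top e ⟩
    part μ j N.+ top N.+ e N.+ bot    ≡⟨ cong (N._+ bot) (proj₂ (closed top)) ⟩
    part μ top N.+ j N.+ bot          ≡⟨ rearrange₂ (part μ top) j bot ⟩
    part μ top N.+ bot N.+ j          ≡⟨ cong (N._+ j) (sym ends) ⟩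
    e N.+ part ν bot N.+ top N.+ j    ≡⟨ rearrange₃ e (part ν bot) top j ⟩
    part ν bot N.+ j N.+ (top N.+ e)  ∎)
    where
    open ≡-Reasoning
    rearrange₁ : ∀ x b a e → x N.+ b N.+ (a N.+ e) ≡ x N.+ a N.+ e N.+ b
    rearrange₁ = solve-∀
    rearrange₂ : ∀ x j b → x N.+ j N.+ b ≡ x N.+ b N.+ j
    rearrange₂ = solve-∀
    rearrange₃ : ∀ e y a j → e N.+ y N.+ a N.+ j ≡ y N.+ j N.+ (a N.+ e)
    rearrange₃ = solve-∀

≤-gap : ∀ {i j} → i Z.≤ j → ∃ λ k → j ≡ i Z.+ + k
≤-gap {i} {j} i≤j = Z.∣ i Z.- j ∣ , trans (split j i) (cong (λ w → i Z.+ w) (sym (ZP.∣-∣-≤ i≤j)))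
  where
  split : ∀ j i → j ≡ i Z.+ (j Z.- i)
  split = ZR.solve-∀

+suc : ∀ z k → z Z.+ + suc k ≡ Z.suc (z Z.+ + k)
+suc z k = assoc z (+ k)
  where
  assoc : ∀ z x → z Z.+ (Z.1ℤ Z.+ x) ≡ Z.1ℤ Z.+ (z Z.+ x)
  assoc = ZR.solve-∀

<-gap : ∀ {i j} → i Z.< j → ∃ λ k → j ≡ i Z.+ + suc k
<-gap {i} i<j with ≤-gap (ZP.i<j⇒suc[i]≤j i<j)
... | k , eq = k , trans eq (trans (assoc i (+ k)) (sym (+suc i k)))
  where
  assoc : ∀ i x → (Z.1ℤ Z.+ i) Z.+ x ≡ Z.1ℤ Z.+ (i Z.+ x)
  assoc = ZR.solve-∀

gap-< : ∀ i k → i Z.< i Z.+ + suc k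
gap-< i k = subst (Z._< i Z.+ + suc k) (ZP.+-identityʳ i) (ZP.+-monoʳ-< i (Z.+<+ (s≤s z≤n)))

<suc⇒<⊎≡ : ∀ {y w} → y Z.< Z.suc w → y Z.< w ⊎ y ≡ w
<suc⇒<⊎≡ {y} {w} y<1+w with y ZP.≟ w
... | yes y≡w = inj₂ y≡w
... | no  y≢w = inj₁ (ZP.≤∧≢⇒< (subst (y Z.≤_) (ZP.pred-suc w) (ZP.i<j⇒i≤pred[j] y<1+w)) y≢w)

cancel-multiple : ∀ R R' q x M → R Z.+ q Z.* M ≡ R' Z.+ (q Z.+ x) Z.* M → R ≡ R' Z.+ x Z.* M
cancel-multiple R R' q x M h = begin
  R                                      ≡⟨ expand R q M ⟩
  R Z.+ q Z.* M Z.- q Z.* M              ≡⟨ cong (λ w → w Z.- q Z.* M) h ⟩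
  R' Z.+ (q Z.+ x) Z.* M Z.- q Z.* M     ≡⟨ contract R' q x M ⟩
  R' Z.+ x Z.* M                         ∎
  where
  open ≡-Reasoning
  expand : ∀ R q M → R ≡ R Z.+ q Z.* M Z.- q Z.* M
  expand = ZR.solve-∀
  contract : ∀ R' q x M → R' Z.+ (q Z.+ x) Z.* M Z.- q Z.* M ≡ R' Z.+ x Z.* M
  contract = ZR.solve-∀

larger-quotient-impossible : ∀ M {R R' q q'} → R N.< M →
  + R Z.+ q Z.* + M ≡ + R' Z.+ q' Z.* + M → q Z.< q' → ⊥
larger-quotient-impossible M {R} {R'} {q} R<M eq q<q' with <-gap q<q'
... | a , refl = NP.<⇒≱ R<M (begin
  M                        ≤⟨ NP.m≤m+n M (a N.* M) ⟩
  suc a N.* M              ≤⟨ NP.m≤n+m _ R' ⟩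
  R' N.+ suc a N.* M       ≡⟨ sym (ZP.+-injective R≡) ⟩
  R                        ∎)
  where
  open NP.≤-Reasoning
  R≡ : + R ≡ + (R' N.+ suc a N.* M)
  R≡ = trans (cancel-multiple (+ R) (+ R') q (+ suc a) (+ M) eq) (cong (λ w → + R' Z.+ w) (sym (ZP.pos-* (suc a) M)))

quotient-unique : ∀ M {R R' q q'} → R N.< M → R' N.< M →
  + R Z.+ q Z.* + M ≡ + R' Z.+ q' Z.* + M → q ≡ q'
quotient-unique M {q = q} {q'} R<M R'<M eq with ZP.<-cmp q q'
... | tri< q<q' _ _ = ⊥-elim (larger-quotient-impossible M R<M eq q<q')
... | tri≈ _ q≡q' _ = q≡q'
... | tri> _ _ q'<q = ⊥-elim (larger-quotient-impossible M R'<M (sym eq) q'<q)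

-∣i∣≤i : ∀ i → Z.- (+ Z.∣ i ∣) Z.≤ i
-∣i∣≤i (+ n)    = ZP.neg-≤-pos
-∣i∣≤i -[1+ n ] = ZP.≤-refl

i≤∣i∣ : ∀ i → i Z.≤ + Z.∣ i ∣
i≤∣i∣ (+ n)    = ZP.≤-refl
i≤∣i∣ -[1+ n ] = Z.-≤+

+-cancelʳ-ℤ : ∀ a b c → a Z.+ c ≡ b Z.+ c → a ≡ b
+-cancelʳ-ℤ a b c h = trans (expand a c) (trans (cong (Z._- c) h) (sym (expand b c)))
  where
  expand : ∀ a c → a ≡ a Z.+ c Z.- c
  expand = ZR.solve-∀

InL-[] : ∀ s k → InL s [] k ⇔ k Z.< s
InL-[] s k = mk⇔ below unbelow
  where
  below : InL s [] k → k Z.< s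
  below (i , refl) = subst (k Z.<_) (sym (restore s (+ suc i))) (gap-< k i)
    where
    restore : ∀ s x → s ≡ ((Z.0ℤ Z.- x) Z.+ s) Z.+ x
    restore = ZR.solve-∀
  unbelow : k Z.< s → InL s [] k
  unbelow k<s with <-gap k<s
  ... | i , refl = i , recover k (+ suc i)
    where
    recover : ∀ k x → k ≡ (Z.0ℤ Z.- x) Z.+ (k Z.+ x)
    recover = ZR.solve-∀

InL-∷ : ∀ t v μ y → InL (Z.suc t) (v ∷ μ) y ⇔ (y ≡ + v Z.+ t ⊎ InL t μ y)
InL-∷ t v μ y = mk⇔ split join
  where
  first : ∀ v t → (v Z.- Z.1ℤ) Z.+ (Z.1ℤ Z.+ t) ≡ v Z.+ t
  first = ZR.solve-∀
  later : ∀ p x t → (p Z.- (Z.1ℤ Z.+ x)) Z.+ (Z.1ℤ Z.+ t) ≡ (p Z.- x) Z.+ t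
  later = ZR.solve-∀
  split : InL (Z.suc t) (v ∷ μ) y → y ≡ + v Z.+ t ⊎ InL t μ y
  split (zero  , y≡) = inj₁ (trans y≡ (first (+ v) t))
  split (suc i , y≡) = inj₂ (i , trans y≡ (later (+ part μ i) (+ suc i) t))
  join : y ≡ + v Z.+ t ⊎ InL t μ y → InL (Z.suc t) (v ∷ μ) y
  join (inj₁ y≡)       = zero  , trans y≡ (sym (first (+ v) t))
  join (inj₂ (i , y≡)) = suc i , trans y≡ (sym (later (+ part μ i) (+ suc i) t))

InL-cong : ∀ {t t' μ μ'} → t ≡ t' → (∀ i → part μ i ≡ part μ' i) → ∀ y → InL t μ y ⇔ InL t' μ' y
InL-cong {t} {μ = μ} {μ'} refl μ≗μ' y = mk⇔ (move μ μ' μ≗μ') (move μ' μ (λ i → sym (μ≗μ' i)))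
  where
  move : ∀ ρ ρ' → (∀ i → part ρ i ≡ part ρ' i) → InL t ρ y → InL t ρ' y
  move ρ ρ' ρ≗ρ' (i , y≡) = i , trans y≡ (cong (λ p → (+ p Z.- + suc i) Z.+ t) (ρ≗ρ' i))

consPart : ℕ → List ℕ → List ℕ
consPart zero    _  = []
consPart (suc v) μ  = suc v ∷ μ

consPart-parts : ∀ {v μ} → IsPartition μ → part μ 0 ≤ v → ∀ i → part (consPart v μ) i ≡ part (v ∷ μ) i
consPart-parts {suc v} _                  _    i       = refl
consPart-parts {zero}  {[]}    _          _    zero    = refl
consPart-parts {zero}  {[]}    _          _    (suc i) = refl
consPart-parts {zero}  {x ∷ μ} (_ , x>0 ∷ _) x≤0 i     = ⊥-elim (NP.<⇒≱ x>0 x≤0)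

consPart-isPartition : ∀ {v μ} → IsPartition μ → part μ 0 ≤ v → IsPartition (consPart v μ)
consPart-isPartition {zero}           _                  _   = Linked.[] , All.[]
consPart-isPartition {suc v} {[]}     (_ , pos)          _   = [-] , (s≤s z≤n ∷ pos)
consPart-isPartition {suc v} {x ∷ μ}  (desc , pos)       x≤v = (x≤v ∷ desc) , (s≤s z≤n ∷ pos)

-- The partition is built by scanning
-- Lo, Lo + 1, …, Lo + n − 1: each member found becomes a new largest
-- β-number, i.e. a new first part of μ.
module FromBetaSet (P : ℤ → Set) (P? : ∀ x → Dec (P x)) (Lo : ℤ) where

  Window : ℕ → ℤ → Set
  Window k y = y Z.< Lo ⊎ (y Z.< Lo Z.+ + k × P y)

  window-step : ∀ k y → Window (suc k) y ⇔ ((y ≡ Lo Z.+ + k × P y) ⊎ Window k y)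
  window-step k y = mk⇔ split join
    where
    split : Window (suc k) y → (y ≡ Lo Z.+ + k × P y) ⊎ Window k y
    split (inj₁ y<Lo)       = inj₂ (inj₁ y<Lo)
    split (inj₂ (y< , py)) with <suc⇒<⊎≡ (subst (y Z.<_) (+suc Lo k) y<)
    ... | inj₁ y<Lo+k = inj₂ (inj₂ (y<Lo+k , py))
    ... | inj₂ y≡Lo+k = inj₁ (y≡Lo+k , py)
    join : (y ≡ Lo Z.+ + k × P y) ⊎ Window k y → Window (suc k) y
    join (inj₁ (refl , py))          = inj₂ (ZP.+-monoʳ-< Lo (Z.+<+ (NP.n<1+n k)) , py)
    join (inj₂ (inj₁ y<Lo))         = inj₁ y<Lo
    join (inj₂ (inj₂ (y<Lo+k , py))) = inj₂ (ZP.<-≤-trans y<Lo+k (ZP.+-monoʳ-≤ Lo (Z.+≤+ (NP.n≤1+n k))) , py)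

  -- State after scanning Lo, …, Lo + k − 1: L_{Lo+c}(μ) = Window k, and the
  -- largest β-number μ_0 + Lo + c − 1 lies below Lo + k.
  Scanned : ℕ → Set
  Scanned k = Σ (List ℕ) λ μ → Σ ℕ λ c →
    IsPartition μ × part μ 0 N.+ c ≤ k × (∀ y → InL (Lo Z.+ + c) μ y ⇔ Window k y)

  scan : ∀ k → Scanned k
  scan zero = [] , 0 , (Linked.[] , All.[]) , z≤n , λ y → mk⇔ (into y) (back y)
    where
    into : ∀ y → InL (Lo Z.+ + 0) [] y → Window 0 y
    into y h = inj₁ (subst (y Z.<_) (ZP.+-identityʳ Lo) (to (InL-[] _ y) h))
    back : ∀ y → Window 0 y → InL (Lo Z.+ + 0) [] y
    back y (inj₁ y<Lo)     = from (InL-[] _ y) (subst (y Z.<_) (sym (ZP.+-identityʳ Lo)) y<Lo)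
    back y (inj₂ (y< , _)) = from (InL-[] _ y) y<
  scan (suc k) with scan k | P? (Lo Z.+ + k)
  ... | μ , c , pμ , head , inv | no ¬p =
    μ , c , pμ , NP.m≤n⇒m≤1+n head , λ y → skip y ⇔-∘ inv y
    where
    skip : ∀ y → Window k y ⇔ Window (suc k) y
    skip y = mk⇔ (λ w → from (window-step k y) (inj₂ w)) drop
      where
      drop : Window (suc k) y → Window k y
      drop w with to (window-step k y) w
      ... | inj₁ (refl , p) = ⊥-elim (¬p p)
      ... | inj₂ w'         = w'
  ... | μ , c , pμ , head , inv | yes p =
    consPart v μ , suc c , consPart-isPartition pμ μ₀≤v , head' ,
    -- the new β-set is the old one together with Lo + k
    λ y → ⇔-sym (window-step k y)
            ⇔-∘ ((new y ⊎-⇔ inv y)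
            ⇔-∘ (InL-∷ _ v μ y
            ⇔-∘ InL-cong {μ = consPart v μ} {μ' = v ∷ μ} (+suc Lo c) parts y))
    where
    v : ℕ
    v = k N.∸ c
    c≤k : c ≤ k
    c≤k = NP.≤-trans (NP.m≤n+m c (part μ 0)) head
    μ₀≤v : part μ 0 ≤ v
    μ₀≤v = subst (_≤ v) (NP.m+n∸n≡m (part μ 0) c) (NP.∸-monoˡ-≤ c head)
    parts : ∀ i → part (consPart v μ) i ≡ part (v ∷ μ) i
    parts = consPart-parts pμ μ₀≤v
    head' : part (consPart v μ) 0 N.+ suc c ≤ suc k
    head' = NP.≤-reflexive (begin
      part (consPart v μ) 0 N.+ suc c ≡⟨ cong (N._+ suc c) (parts 0) ⟩
      v N.+ suc c                     ≡⟨ NP.+-suc v c ⟩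
      suc (v N.+ c)                   ≡⟨ cong suc (NP.m∸n+n≡m c≤k) ⟩
      suc k                           ∎)
      where open ≡-Reasoning
    newβ : + v Z.+ (Lo Z.+ + c) ≡ Lo Z.+ + k
    newβ = begin
      + v Z.+ (Lo Z.+ + c)  ≡⟨ rearrange (+ v) Lo (+ c) ⟩
      Lo Z.+ (+ v Z.+ + c)  ≡⟨ cong (λ w → Lo Z.+ + w) (NP.m∸n+n≡m c≤k) ⟩
      Lo Z.+ + k            ∎
      where
      open ≡-Reasoning
      rearrange : ∀ v Lo c → v Z.+ (Lo Z.+ c) ≡ Lo Z.+ (v Z.+ c)
      rearrange = ZR.solve-∀
    new : ∀ y → (y ≡ + v Z.+ (Lo Z.+ + c)) ⇔ (y ≡ Lo Z.+ + k × P y)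
    new y = mk⇔ (λ y≡ → trans y≡ newβ , subst P (sym (trans y≡ newβ)) p)
                (λ (y≡ , _) → trans y≡ (sym newβ))

  betaSet : ∀ Hi → Lo Z.≤ Hi → (∀ y → y Z.< Lo → P y) → (∀ y → P y → y Z.< Hi) →
    Σ (List ℕ) λ μ → Σ ℤ λ t → IsPartition μ × (∀ y → P y ⇔ InL t μ y)
  betaSet Hi Lo≤Hi below above with ≤-gap Lo≤Hi
  ... | n , refl with scan n
  ...   | μ , c , pμ , _ , inv = μ , Lo Z.+ + c , pμ , λ y → ⇔-sym (inv y) ⇔-∘ mk⇔ (into y) (back y)
    where
    into : ∀ y → P y → Window n y
    into y py = inj₂ (above y py , py)
    back : ∀ y → Window n y → P y
    back y (inj₁ y<Lo)     = below y y<Lo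
    back y (inj₂ (_ , py)) = py

closed-parts : ∀ {t μ e} → (∀ x → InL t μ x → InL t μ (x Z.- + e)) →
  ∀ i → ∃ λ j → part μ j N.+ i N.+ e ≡ part μ i N.+ j
closed-parts {t} {μ} {e} closed i with closed _ (i , refl)
... | j , eq = j , NP.suc-injective (begin
  suc (part μ j N.+ i N.+ e)    ≡⟨ cong (N._+ e) (sym (NP.+-suc (part μ j) i)) ⟩
  part μ j N.+ suc i N.+ e      ≡⟨ ZP.+-injective (rearrange (+ part μ i) (+ suc i) (+ part μ j) (+ suc j) t (+ e) eq) ⟩
  part μ i N.+ suc j            ≡⟨ NP.+-suc (part μ i) j ⟩
  suc (part μ i N.+ j)          ∎)
  where
  open ≡-Reasoning
  rearrange : ∀ a b c d t e → ((a Z.- b) Z.+ t) Z.- e ≡ (c Z.- d) Z.+ t → c Z.+ b Z.+ e ≡ a Z.+ d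
  rearrange a b c d t e h = begin
    c Z.+ b Z.+ e                                       ≡⟨ expand a b c d t e ⟩
    ((c Z.- d) Z.+ t) Z.- t Z.+ d Z.+ b Z.+ e           ≡⟨ cong (λ w → w Z.- t Z.+ d Z.+ b Z.+ e) (sym h) ⟩
    (((a Z.- b) Z.+ t) Z.- e) Z.- t Z.+ d Z.+ b Z.+ e   ≡⟨ contract a b c d t e ⟩
    a Z.+ d                                             ∎
    where
    expand : ∀ a b c d t e → c Z.+ b Z.+ e ≡ ((c Z.- d) Z.+ t) Z.- t Z.+ d Z.+ b Z.+ e
    expand = ZR.solve-∀
    contract : ∀ a b c d t e → (((a Z.- b) Z.+ t) Z.- e) Z.- t Z.+ d Z.+ b Z.+ e ≡ a Z.+ d
    contract = ZR.solve-∀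

coreBetaSet : ∀ (P : ℤ → Set) → (∀ x → Dec (P x)) → ∀ {e} → 1 ≤ e →
  ∀ {Lo Hi} → Lo Z.≤ Hi → (∀ y → y Z.< Lo → P y) → (∀ y → P y → y Z.< Hi) →
  (∀ x → P x → P (x Z.- + e)) →
  Σ (List ℕ) λ μ → Σ ℤ λ t → IsPartition μ × (∀ x → P x ⇔ InL t μ x) × IsCore e μ
coreBetaSet P P? {e} e≥1 {Lo} {Hi} Lo≤Hi below above closed
  with FromBetaSet.betaSet P P? Lo Hi Lo≤Hi below above
... | μ , t , pμ , P⇔L = μ , t , pμ , P⇔L , closed⇒core e≥1 pμ (closed-parts {μ = μ} closedL)
  where
  closedL : ∀ x → InL t μ x → InL t μ (x Z.- + e)
  closedL x x∈L = to (P⇔L _) (closed x (from (P⇔L x) x∈L))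

-- The Uglov set of the empty l-partition with charge s ∈ Ā^l_e, where
-- e = e' + 1 and l = l' + 1.  Component c (0-indexed) contributes the
-- integers (l−1−c)e + q·el + r with 0 ≤ r < e and qe + r < s_c.
module EmptyUglov (e' l' : ℕ) (s : Fin (suc l') → ℤ) (abar : InAbar (suc e') (suc l') s) where

  E L M : ℕ
  E = suc e'
  L = suc l'
  M = E N.* L

  U : ℤ → Set
  U = UglovSet E L (λ _ → []) s

  charge-window : ∀ c → s F.zero Z.≤ s c × s c Z.≤ s F.zero Z.+ + E
  charge-window F.zero    = ZP.≤-refl , ZP.i≤i+j (s F.zero) (+ E)
  charge-window (F.suc c) = abar F.zero (F.suc c) (s≤s z≤n)

  -- component c sits at offset (l−1−c)·e inside every block of M = el integers
  offset : Fin L → ℕ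
  offset c = L N.∸ suc (F.toℕ c)

  position<M : ∀ c {r} → r N.< E → r N.+ offset c N.* E N.< M
  position<M c {r} r<E = begin-strict
    r N.+ offset c N.* E   <⟨ NP.+-monoˡ-< (offset c N.* E) r<E ⟩
    suc (offset c) N.* E   ≤⟨ NP.*-monoˡ-≤ E (s≤s (NP.m∸n≤m l' (F.toℕ c))) ⟩
    L N.* E                ≡⟨ NP.*-comm L E ⟩
    M                      ∎
    where open NP.≤-Reasoning

  component : ∀ b → b N.< L → Σ (Fin L) λ c → offset c ≡ b
  component b b<L = c , trans (cong (λ w → L N.∸ suc w) (FP.toℕ-fromℕ< l'∸b<L)) (NP.m∸[m∸n]≡n (NP.≤-pred b<L))
    where
    l'∸b<L : l' N.∸ b N.< L
    l'∸b<L = s≤s (NP.m∸n≤m l' b)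
    c : Fin L
    c = F.fromℕ< l'∸b<L

  Member : ℤ → Set
  Member x = Σ (Fin L) λ c → Σ ℤ λ q → Σ ℕ λ r →
    r N.< E × q Z.* + E Z.+ + r Z.< s c × x ≡ (+ (offset c N.* E) Z.+ q Z.* + M) Z.+ + r

  member : ∀ {x} → Member x → U x
  member (c , q , r , r<E , below-s , x≡) =
    c , q Z.* + E Z.+ + r , q , r , from (InL-[] _ _) below-s , r<E , refl , x≡

  unmember : ∀ {x} → U x → Member x
  unmember (c , k , q , r , k∈L , r<E , k≡ , x≡) =
    c , q , r , r<E , subst (Z._< s c) k≡ (to (InL-[] _ _) k∈L) , x≡

  Q : ℤ → ℤ
  Q x = x ZD./ℕ M
  R Rr Rc : ℤ → ℕ
  R x  = x ZD.%ℕ M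
  Rr x = R x ND.% E
  Rc x = R x ND./ E

  divmod-M : ∀ x → x ≡ + R x Z.+ Q x Z.* + M
  divmod-M x = ZD.a≡a%ℕn+[a/ℕn]*n x M

  divmod-E : ∀ x → R x ≡ Rr x N.+ Rc x N.* E
  divmod-E x = ND.m≡m%n+[m/n]*n (R x) E

  position-unique : ∀ x c q r → r N.< E → x ≡ (+ (offset c N.* E) Z.+ q Z.* + M) Z.+ + r →
    q ≡ Q x × r ≡ Rr x × offset c ≡ Rc x
  position-unique x c q r r<E x≡ = q≡ , sym Rr≡ , sym Rc≡
    where
    o : ℕ
    o = offset c
    regroup : ∀ a b c → (a Z.+ b) Z.+ c ≡ c Z.+ a Z.+ b
    regroup = ZR.solve-∀
    same : + (r N.+ o N.* E) Z.+ q Z.* + M ≡ + R x Z.+ Q x Z.* + M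
    same = trans (sym (trans x≡ (regroup (+ (o N.* E)) (q Z.* + M) (+ r)))) (divmod-M x)
    q≡ : q ≡ Q x
    q≡ = quotient-unique M (position<M c r<E) (ZD.n%ℕd<d x M) same
    R≡ : r N.+ o N.* E ≡ R x
    R≡ = ZP.+-injective (+-cancelʳ-ℤ _ _ (Q x Z.* + M)
           (subst (λ w → + (r N.+ o N.* E) Z.+ w Z.* + M ≡ + R x Z.+ Q x Z.* + M) q≡ same))
    Rr≡ : Rr x ≡ r
    Rr≡ = trans (cong (ND._% E) (sym R≡)) (trans (ND.[m+kn]%n≡m%n r o E) (ND.m<n⇒m%n≡m r<E))
    Rc≡ : Rc x ≡ o
    Rc≡ = NP.*-cancelʳ-≡ (Rc x) o E (NP.+-cancelˡ-≡ r _ _ (begin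
      r N.+ Rc x N.* E      ≡⟨ cong (N._+ Rc x N.* E) (sym Rr≡) ⟩
      Rr x N.+ Rc x N.* E   ≡⟨ sym (divmod-E x) ⟩
      R x                   ≡⟨ sym R≡ ⟩
      r N.+ o N.* E         ∎))
      where open ≡-Reasoning

  Criterion : ℤ → Set
  Criterion x = Σ (Fin L) λ c → offset c ≡ Rc x × Q x Z.* + E Z.+ + Rr x Z.< s c

  criterion : ∀ x → U x ⇔ Criterion x
  criterion x = mk⇔ necessary sufficient
    where
    necessary : U x → Criterion x
    necessary u with unmember u
    ... | c , q , r , r<E , below-s , x≡ with position-unique x c q r r<E x≡
    ...   | refl , refl , o≡ = c , o≡ , below-s
    sufficient : Criterion x → U x
    sufficient (c , o≡ , below-s) = member (c , Q x , Rr x , ND.m%n<n (R x) E , below-s , x≡)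
      where
      regroup : ∀ a b c → (a Z.+ b) Z.+ c ≡ (b Z.+ c) Z.+ a
      regroup = ZR.solve-∀
      x≡ : x ≡ (+ (offset c N.* E) Z.+ Q x Z.* + M) Z.+ + Rr x
      x≡ = begin
        x                                                ≡⟨ divmod-M x ⟩
        + R x Z.+ Q x Z.* + M                            ≡⟨ cong (λ w → + w Z.+ Q x Z.* + M) (divmod-E x) ⟩
        + (Rr x N.+ Rc x N.* E) Z.+ Q x Z.* + M          ≡⟨ cong (λ w → + (Rr x N.+ w N.* E) Z.+ Q x Z.* + M) (sym o≡) ⟩
        + Rr x Z.+ + (offset c N.* E) Z.+ Q x Z.* + M    ≡⟨ regroup (+ Rr x) (+ (offset c N.* E)) (Q x Z.* + M) ⟩
        (+ (offset c N.* E) Z.+ Q x Z.* + M) Z.+ + Rr x  ∎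
        where open ≡-Reasoning

  U? : ∀ x → Dec (U x)
  U? x = Dec.map (⇔-sym (criterion x))
    (FP.any? λ c → (offset c N.≟ Rc x) ×-dec (Q x Z.* + E Z.+ + Rr x Z.<? s c))

  -- moving one step down to the next component keeps q and r
  shift-next : ∀ {x} c q r → r N.< E → q Z.* + E Z.+ + r Z.< s c →
    x ≡ (+ (offset c N.* E) Z.+ q Z.* + M) Z.+ + r → F.toℕ c N.< l' → U (x Z.- + E)
  shift-next {x} c q r r<E below-s x≡ c<l' = member (next , q , r , r<E , ZP.<-≤-trans below-s s-step , x-E≡)
    where
    next : Fin L
    next = F.fromℕ< (s≤s c<l')
    next≡ : F.toℕ next ≡ suc (F.toℕ c)
    next≡ = FP.toℕ-fromℕ< (s≤s c<l')
    s-step : s c Z.≤ s next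
    s-step = proj₁ (abar c next (subst (F.toℕ c N.<_) (sym next≡) NP.≤-refl))
    offset≡ : offset c ≡ suc (offset next)
    offset≡ = trans (NP.+-∸-assoc 1 c<l') (cong (λ w → suc (L N.∸ suc w)) (sym next≡))
    drop-e : ∀ e b qM r → ((e Z.+ b) Z.+ qM) Z.+ r Z.- e ≡ (b Z.+ qM) Z.+ r
    drop-e = ZR.solve-∀
    x-E≡ : x Z.- + E ≡ (+ (offset next N.* E) Z.+ q Z.* + M) Z.+ + r
    x-E≡ = begin
      x Z.- + E                                                       ≡⟨ cong (Z._- + E) x≡ ⟩
      (+ (offset c N.* E) Z.+ q Z.* + M) Z.+ + r Z.- + E               ≡⟨ cong (λ w → (+ (w N.* E) Z.+ q Z.* + M) Z.+ + r Z.- + E) offset≡ ⟩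
      (+ (E N.+ offset next N.* E) Z.+ q Z.* + M) Z.+ + r Z.- + E      ≡⟨ drop-e (+ E) (+ (offset next N.* E)) (q Z.* + M) (+ r) ⟩
      (+ (offset next N.* E) Z.+ q Z.* + M) Z.+ + r                    ∎
      where open ≡-Reasoning

  -- from the last component, x − e wraps around to the first one with q − 1
  shift-wrap : ∀ {x} c q r → r N.< E → q Z.* + E Z.+ + r Z.< s c →
    x ≡ (+ (offset c N.* E) Z.+ q Z.* + M) Z.+ + r → ¬ F.toℕ c N.< l' → U (x Z.- + E)
  shift-wrap {x} c q r r<E below-s x≡ c≮l' = member (F.zero , q Z.- Z.1ℤ , r , r<E , below-s₀ , x-E≡)
    where
    c≡l' : F.toℕ c ≡ l'
    c≡l' = NP.≤-antisym (NP.≤-pred (FP.toℕ<n c)) (NP.≮⇒≥ c≮l')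
    offset≡0 : offset c ≡ 0
    offset≡0 = trans (cong (l' N.∸_) c≡l') (NP.n∸n≡0 l')
    lower : ∀ q e r → (q Z.- Z.1ℤ) Z.* e Z.+ r ≡ q Z.* e Z.+ r Z.- e
    lower = ZR.solve-∀
    restore : ∀ a e → a Z.+ e Z.- e ≡ a
    restore = ZR.solve-∀
    below-s₀ : (q Z.- Z.1ℤ) Z.* + E Z.+ + r Z.< s F.zero
    below-s₀ = begin-strict
      (q Z.- Z.1ℤ) Z.* + E Z.+ + r  ≡⟨ lower q (+ E) (+ r) ⟩
      q Z.* + E Z.+ + r Z.- + E     <⟨ ZP.+-monoˡ-< (Z.- + E) below-s ⟩
      s c Z.- + E                   ≤⟨ ZP.+-monoˡ-≤ (Z.- + E) (proj₂ (charge-window c)) ⟩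
      s F.zero Z.+ + E Z.- + E      ≡⟨ restore (s F.zero) (+ E) ⟩
      s F.zero                      ∎
      where open ZP.≤-Reasoning
    wrap : ∀ e l q r → ((Z.0ℤ Z.+ q Z.* (e Z.* (Z.1ℤ Z.+ l))) Z.+ r) Z.- e
                     ≡ (l Z.* e Z.+ (q Z.- Z.1ℤ) Z.* (e Z.* (Z.1ℤ Z.+ l))) Z.+ r
    wrap = ZR.solve-∀
    M≡ : + M ≡ + E Z.* (Z.1ℤ Z.+ + l')
    M≡ = ZP.pos-* E L
    x-E≡ : x Z.- + E ≡ (+ (offset F.zero N.* E) Z.+ (q Z.- Z.1ℤ) Z.* + M) Z.+ + r
    x-E≡ = begin
      x Z.- + E                                                        ≡⟨ cong (Z._- + E) x≡ ⟩
      (+ (offset c N.* E) Z.+ q Z.* + M) Z.+ + r Z.- + E                ≡⟨ cong (λ w → (+ (w N.* E) Z.+ q Z.* + M) Z.+ + r Z.- + E) offset≡0 ⟩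
      (Z.0ℤ Z.+ q Z.* + M) Z.+ + r Z.- + E                              ≡⟨ cong (λ w → (Z.0ℤ Z.+ q Z.* w) Z.+ + r Z.- + E) M≡ ⟩
      (Z.0ℤ Z.+ q Z.* (+ E Z.* (Z.1ℤ Z.+ + l'))) Z.+ + r Z.- + E        ≡⟨ wrap (+ E) (+ l') q (+ r) ⟩
      (+ l' Z.* + E Z.+ (q Z.- Z.1ℤ) Z.* (+ E Z.* (Z.1ℤ Z.+ + l'))) Z.+ + r
                                                                       ≡⟨ cong₂ (λ u w → (u Z.+ (q Z.- Z.1ℤ) Z.* w) Z.+ + r) (sym (ZP.pos-* l' E)) (sym M≡) ⟩
      (+ (offset F.zero N.* E) Z.+ (q Z.- Z.1ℤ) Z.* + M) Z.+ + r        ∎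
      where open ≡-Reasoning

  -- U is closed under x ↦ x − e, because s_0 ≤ s_1 ≤ … ≤ s_{l−1} ≤ s_0 + e.
  shift-closed : ∀ x → U x → U (x Z.- + E)
  shift-closed x u with unmember u
  ... | c , q , r , r<E , below-s , x≡ with F.toℕ c N.<? l'
  ...   | yes c<l' = shift-next c q r r<E below-s x≡ c<l'
  ...   | no  c≮l' = shift-wrap c q r r<E below-s x≡ c≮l'

  A : ℕ
  A = Z.∣ s F.zero ∣

  Lo Hi : ℤ
  Lo = Z.- (+ A) Z.* + M
  Hi = + suc A Z.* + M

  Lo≤Hi : Lo Z.≤ Hi
  Lo≤Hi = ZP.*-monoʳ-≤-nonNeg (+ M) (ZP.neg-≤-pos {A} {suc A})

  below-Lo : ∀ y → y Z.< Lo → U y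
  below-Lo y y<Lo = from (criterion y) (c , o≡ , below-s)
    where
    Rc<L : Rc y N.< L
    Rc<L = ND.m<n*o⇒m/o<n (subst (R y N.<_) (NP.*-comm E L) (ZD.n%ℕd<d y M))
    c : Fin L
    c = proj₁ (component (Rc y) Rc<L)
    o≡ : offset c ≡ Rc y
    o≡ = proj₂ (component (Rc y) Rc<L)
    QM≤y : Q y Z.* + M Z.≤ y
    QM≤y = subst (Q y Z.* + M Z.≤_) (trans (ZP.+-comm (Q y Z.* + M) (+ R y)) (sym (divmod-M y)))
             (ZP.i≤i+j (Q y Z.* + M) (+ R y))
    Q<-A : Q y Z.< Z.- (+ A)
    Q<-A = ZP.*-cancelʳ-<-nonNeg (+ M) (ZP.≤-<-trans QM≤y y<Lo)
    next-multiple : ∀ q e → q Z.* e Z.+ e ≡ (Z.1ℤ Z.+ q) Z.* e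
    next-multiple = ZR.solve-∀
    -A*E≤-A : Z.- (+ A) Z.* + E Z.≤ Z.- (+ A)
    -A*E≤-A = subst (Z._≤ Z.- (+ A)) (trans (cong Z.-_ (ZP.pos-* A E)) (ZP.neg-distribˡ-* (+ A) (+ E)))
                (ZP.neg-mono-≤ (Z.+≤+ (NP.m≤m*n A E)))
    below-s : Q y Z.* + E Z.+ + Rr y Z.< s c
    below-s = begin-strict
      Q y Z.* + E Z.+ + Rr y    <⟨ ZP.+-monoʳ-< (Q y Z.* + E) (Z.+<+ (ND.m%n<n (R y) E)) ⟩
      Q y Z.* + E Z.+ + E       ≡⟨ next-multiple (Q y) (+ E) ⟩
      Z.suc (Q y) Z.* + E       ≤⟨ ZP.*-monoʳ-≤-nonNeg (+ E) (ZP.i<j⇒suc[i]≤j Q<-A) ⟩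
      Z.- (+ A) Z.* + E         ≤⟨ -A*E≤-A ⟩
      Z.- (+ A)                 ≤⟨ -∣i∣≤i (s F.zero) ⟩
      s F.zero                  ≤⟨ proj₁ (charge-window c) ⟩
      s c                       ∎
      where open ZP.≤-Reasoning

  below-Hi : ∀ y → U y → y Z.< Hi
  below-Hi y u with unmember u
  ... | c , q , r , r<E , below-s , y≡ = begin-strict
    y                                         ≡⟨ trans y≡ (regroup (+ (offset c N.* E)) (q Z.* + M) (+ r)) ⟩
    + (offset c N.* E) Z.+ + r Z.+ q Z.* + M   ≡⟨ cong (Z._+ q Z.* + M) (trans (sym (ZP.pos-+ (offset c N.* E) r)) (cong +_ (NP.+-comm _ r))) ⟩
    + (r N.+ offset c N.* E) Z.+ q Z.* + M     <⟨ ZP.+-monoˡ-< (q Z.* + M) (Z.+<+ (position<M c r<E)) ⟩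
    + M Z.+ q Z.* + M                          ≡⟨ next-multiple (+ M) q ⟩
    Z.suc q Z.* + M                            ≤⟨ ZP.*-monoʳ-≤-nonNeg (+ M) (ZP.i<j⇒suc[i]≤j q<1+A) ⟩
    Hi                                         ∎
    where
    open ZP.≤-Reasoning
    regroup : ∀ b qM r → (b Z.+ qM) Z.+ r ≡ b Z.+ r Z.+ qM
    regroup = ZR.solve-∀
    next-multiple : ∀ m q → m Z.+ q Z.* m ≡ (Z.1ℤ Z.+ q) Z.* m
    next-multiple = ZR.solve-∀
    qE<1+A*E : q Z.* + E Z.< + suc A Z.* + E
    qE<1+A*E = begin-strict
      q Z.* + E              ≤⟨ ZP.i≤i+j (q Z.* + E) (+ r) ⟩
      q Z.* + E Z.+ + r      <⟨ below-s ⟩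
      s c                    ≤⟨ proj₂ (charge-window c) ⟩
      s F.zero Z.+ + E       ≤⟨ ZP.+-monoˡ-≤ (+ E) (i≤∣i∣ (s F.zero)) ⟩
      + (A N.+ E)            ≤⟨ Z.+≤+ (NP.≤-trans (NP.≤-reflexive (NP.+-comm A E)) (NP.+-monoʳ-≤ E (NP.m≤m*n A E))) ⟩
      + suc A Z.* + E        ∎
    q<1+A : q Z.< + suc A
    q<1+A = ZP.*-cancelʳ-<-nonNeg (+ E) qE<1+A*E

mainTheorem2 : (e l : ℕ) → 2 ≤ e → 1 ≤ l → (s : Fin l → ℤ) → InAbar e l s →
    Σ (List ℕ) λ μ → Σ ℤ λ t →
    IsPartition μ × (∀ x → UglovSet e l (λ _ → []) s x ⇔ InL t μ x) × IsCore e μ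
mainTheorem2 zero          l        ()          _  s abar
mainTheorem2 (suc zero)    l        (s≤s ())    _  s abar
mainTheorem2 (suc (suc e')) zero    _           () s abar
mainTheorem2 (suc (suc e')) (suc l') _ _ s abar =
  coreBetaSet U U? (s≤s z≤n) Lo≤Hi below-Lo below-Hi shift-closed
  where open EmptyUglov (suc e') l' s abar
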